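{- Write the Tribonacci word as $\mathbf{t}=u_0u_1u_2\cdots$ with $u_i\in\{0,1,2\}$, and let $\beta$ be the real root of $x^3-x^2-x-1$. Then for every nonnegative integer $N$, $$-0.775<|u_0u_1\cdots u_{N-1}|_1-\frac{N}{\beta^2}<0.725.$$
   Context: Let $\tau$ be the morphism on $\{0,1,2\}^*$ given by $0\mapsto 01$, $1\mapsto 02$, $2\mapsto 0$, and let $\mathbf{t}=\lim_{n\to\infty}\tau^n(0)$ be its fixed point. For a finite word $w$, $|w|_a$ denotes the number of occurrences of the letter $a$ in $w$. ($\beta\approx1.83928$.) -}

module Defs where

open import Data.Nat using (ℕ; zero; suc)
open import Data.Integer using (+_)
open import Data.List using (List; []; _∷_; _++_; take; length; filter; concatMap)
open import Data.Rational using (ℚ; _/_; _<_; _*_; _+_; _-_; 0ℚ)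
open import Data.Product using (∃; _×_)
open import Relation.Nullary using (Dec; yes; no)
open import Relation.Binary.PropositionalEquality using (_≡_; refl)

data Letter : Set where
  a0 a1 a2 : Letter

_≟L_ : (x y : Letter) → Dec (x ≡ y)
a0 ≟L a0 = yes refl
a1 ≟L a1 = yes refl
a2 ≟L a2 = yes refl
a0 ≟L a1 = no λ ()
a0 ≟L a2 = no λ ()
a1 ≟L a0 = no λ ()
a1 ≟L a2 = no λ ()
a2 ≟L a0 = no λ ()
a2 ≟L a1 = no λ ()

τ₁ : Letter → List Letter
τ₁ a0 = a0 ∷ a1 ∷ []
τ₁ a1 = a0 ∷ a2 ∷ []
τ₁ a2 = a0 ∷ []

τ : List Letter → List Letter
τ = concatMap τ₁

τ^ : ℕ → List Letter → List Letter
τ^ zero w = w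
τ^ (suc n) w = τ (τ^ n w)

-- u₀u₁⋯u_{N-1}, the length-N prefix of the fixed point t = lim τ^n(0).
-- τ^N(0) is a prefix of t of length ≥ N, so its first N letters are those of t.
prefix : ℕ → List Letter
prefix N = take N (τ^ N (a0 ∷ []))

count : Letter → List Letter → ℕ
count a w = length (filter (λ x → x ≟L a) w)

ℕ→ℚ : ℕ → ℚ
ℕ→ℚ n = + n / 1

-- f(x) = x³ - x² - x - 1 ; β is its unique real root, and for real x,
-- f(x) < 0 ⟺ x < β and f(x) > 0 ⟺ x > β.
f : ℚ → ℚ
f r = r * r * r - r * r - r - (+ 1 / 1)

-- For rationals a and N ∈ ℕ:
-- Nβ⁻²-lt N a  means  "N/β² < a"  :⟺ there is a rational r with 0 < r < β and N < a·r²  (i.e. N/r² < a)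
-- lt-Nβ⁻² a N  means  "a < N/β²"  :⟺ there is a rational r with β < r and a·r² < N      (i.e. a < N/r²)
-- These are exactly the real inequalities, by continuity/monotonicity of N/x² on x > 0.
Nβ⁻²-lt : ℕ → ℚ → Set
Nβ⁻²-lt N a = ∃ λ r → (0ℚ < r) × (f r < 0ℚ) × (ℕ→ℚ N < a * (r * r))

lt-Nβ⁻² : ℚ → ℕ → Set
lt-Nβ⁻² a N = ∃ λ r → (0ℚ < r) × (0ℚ < f r) × (a * (r * r) < ℕ→ℚ N)

-- Let σ = τ¹³ and, for rational t, D₁ t w = |w|₁ − t²|w| and D₀ t w = |w|₀ − t|w|.
-- Both are additive in w, so D(σ w) is an affine combination of D₁ t w, D₀ t w and |w|:
-- for t close to 1/β the coefficients of D₁ and D₀ are below 0.02, and the coefficient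
-- of |w| is a multiple of g t = 1 − t − t² − t³, which vanishes at t = 1/β.  Every prefix
-- of the Tribonacci word is σ(p) followed by a prefix of σ(0), where p is a much shorter
-- prefix; by induction, and an exhaustive check of the 3136 prefixes of σ(0), the
-- discrepancies of every prefix of length N stay in a fixed window up to an error ε N,
-- where |g t| ≤ ε.  As β is irrational we argue with rationals t on either side of 1/β:
-- trisection produces such t with |g t| N negligible, and r = 1/t is the witness for the
-- two comparisons with N/β².
module Submission where

open import Defs
open import Data.Bool using (Bool; true; T; _∧_)
open import Data.Bool.Properties using (T-∧; T-≡)
open import Data.Integer using (+_)
import Data.Integer as ℤ
import Data.Integer.Properties as ℤ
import Data.Integer.Tactic.RingSolver as ℤ-Solver
open import Data.List using (List; []; _∷_; [_]; _++_; take; drop; length; filter; concatMap)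
open import Data.List.Properties using (length-++; ++-assoc; ++-identityʳ; concatMap-++; filter-++; length-take)
open import Data.Nat as ℕ using (ℕ; zero; suc; s≤s)
import Data.Nat.Coprimality as Coprimality
open import Data.Nat.Induction using (<-rec)
import Data.Nat.Properties as ℕ
open import Data.Product using (Σ-syntax; ∃; _×_; _,_; proj₁; proj₂)
open import Data.Sum using (inj₁; inj₂)
open import Function using (_∘_; Equivalence)
open import Relation.Binary.PropositionalEquality
  using (_≡_; refl; sym; trans; cong; cong₂; subst; subst₂; module ≡-Reasoning)
open import Relation.Nullary using (Dec; yes; no)
open import Relation.Nullary.Decidable using (True; toWitness; dec⇒maybe)
open import Tactic.RingSolver using (solve-∀)
open import Tactic.RingSolver.Core.AlmostCommutativeRing using (AlmostCommutativeRing; fromCommutativeRing)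

module Prefixes where

  open import Data.Nat using (_+_; _*_; _∸_; _≤_; _<_; _≤?_; z≤n; s≤s)
  open import Data.Nat.Properties
    using (≤-refl; ≤-trans; ≤-total; <⇒≤; +-comm; *-suc; +-mono-≤; +-mono-<-≤; m≤m+n; +-cancelˡ-<;
           <-≤-connex; m≤n⇒∃[o]m+o≡n; m∸n+n≡m; m≤n⇒m⊓n≡m; module ≤-Reasoning)

  module _ {A : Set} where

    take-++-≤ : ∀ n (xs ys : List A) → n ≤ length xs → take n (xs ++ ys) ≡ take n xs
    take-++-≤ zero    xs       ys _        = refl
    take-++-≤ (suc n) (x ∷ xs) ys (s≤s n≤) = cong (x ∷_) (take-++-≤ n xs ys n≤)

    take-length-++ : ∀ n (xs ys : List A) → take (length xs + n) (xs ++ ys) ≡ xs ++ take n ys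
    take-length-++ n []       ys = refl
    take-length-++ n (x ∷ xs) ys = cong (x ∷_) (take-length-++ n xs ys)

  module _ {A B : Set} (h : A → List B) where

    record TakeConcatMap (w : List A) (N : ℕ) : Set where
      field
        j L    : ℕ
        x      : A
        j≤     : j ≤ length w
        L<     : L < length (h x)
        take-≡ : take N (concatMap h w) ≡ concatMap h (take j w) ++ take L (h x)

    take-concatMap : ∀ w N → N < length (concatMap h w) → TakeConcatMap w N
    take-concatMap []      N ()
    take-concatMap (x ∷ w) N N< with <-≤-connex N (length (h x))
    ... | inj₁ N<hx = record
      { j = 0 ; L = N ; x = x ; j≤ = z≤n ; L< = N<hx
      ; take-≡ = take-++-≤ N (h x) (concatMap h w) (<⇒≤ N<hx) }
    ... | inj₂ hx≤N with N' , refl ← m≤n⇒∃[o]m+o≡n hx≤N = record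
      { j = suc j ; L = L ; x = y ; j≤ = s≤s j≤ ; L< = L<
      ; take-≡ = begin
          take (length (h x) + N') (h x ++ concatMap h w)    ≡⟨ take-length-++ N' (h x) (concatMap h w) ⟩
          h x ++ take N' (concatMap h w)                     ≡⟨ cong (h x ++_) take-≡ ⟩
          h x ++ (concatMap h (take j w) ++ take L (h y))    ≡⟨ ++-assoc (h x) _ _ ⟨
          concatMap h (take (suc j) (x ∷ w)) ++ take L (h y) ∎ }
      where
      open ≡-Reasoning
      N'< : N' < length (concatMap h w)
      N'< = +-cancelˡ-< (length (h x)) N' _ (subst (_ <_) (length-++ (h x)) N<)
      open TakeConcatMap (take-concatMap w N' N'<) renaming (x to y)

  τ^-++ : ∀ n xs ys → τ^ n (xs ++ ys) ≡ τ^ n xs ++ τ^ n ys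
  τ^-++ zero    xs ys = refl
  τ^-++ (suc n) xs ys = trans (cong τ (τ^-++ n xs ys)) (concatMap-++ τ₁ (τ^ n xs) (τ^ n ys))

  τ^-[] : ∀ n → τ^ n [] ≡ []
  τ^-[] zero    = refl
  τ^-[] (suc n) = cong τ (τ^-[] n)

  τ^-concatMap : ∀ n w → τ^ n w ≡ concatMap (λ x → τ^ n [ x ]) w
  τ^-concatMap n []      = τ^-[] n
  τ^-concatMap n (x ∷ w) = trans (τ^-++ n [ x ] w) (cong (τ^ n [ x ] ++_) (τ^-concatMap n w))

  τ^-+ : ∀ m n w → τ^ (m + n) w ≡ τ^ m (τ^ n w)
  τ^-+ zero    n w = refl
  τ^-+ (suc m) n w = cong τ (τ^-+ m n w)

  τ^-suc : ∀ n w → τ^ (suc n) w ≡ τ^ n (τ w)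
  τ^-suc zero    w = refl
  τ^-suc (suc n) w = cong τ (τ^-suc n w)

  length-τ : ∀ w → length w ≤ length (τ w)
  length-τ []      = z≤n
  length-τ (x ∷ w) = subst (suc (length w) ≤_) (sym (length-++ (τ₁ x))) (+-mono-≤ (nonempty x) (length-τ w))
    where
    nonempty : ∀ x → 1 ≤ length (τ₁ x)
    nonempty a0 = s≤s z≤n
    nonempty a1 = s≤s z≤n
    nonempty a2 = s≤s z≤n

  length-τ^ : ∀ n w → length w ≤ length (τ^ n w)
  length-τ^ zero    w = ≤-refl
  length-τ^ (suc n) w = ≤-trans (length-τ^ n w) (length-τ (τ^ n w))

  tribWord : ℕ → List Letter
  tribWord k = τ^ k [ a0 ]

  tribWord-suc : ∀ k → tribWord (suc k) ≡ tribWord k ++ τ^ k [ a1 ]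
  tribWord-suc k = trans (τ^-suc k [ a0 ]) (τ^-++ k [ a0 ] [ a1 ])

  n<length-tribWord : ∀ n → n < length (tribWord n)
  n<length-tribWord zero    = s≤s z≤n
  n<length-tribWord (suc n) = begin-strict
    suc n                                      ≡⟨ +-comm 1 n ⟩
    n + 1                                      <⟨ +-mono-<-≤ (n<length-tribWord n) (length-τ^ n [ a1 ]) ⟩
    length (tribWord n) + length (τ^ n [ a1 ]) ≡⟨ length-++ (tribWord n) ⟨
    length (tribWord n ++ τ^ n [ a1 ])         ≡⟨ cong length (tribWord-suc n) ⟨
    length (tribWord (suc n))                  ∎
    where open ≤-Reasoning

  tribWord-mono : ∀ {k m} → k ≤ m → ∃ λ rest → tribWord m ≡ tribWord k ++ rest
  tribWord-mono {k} {m} k≤m =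
    subst (λ n → ∃ λ rest → tribWord n ≡ tribWord k ++ rest) (m∸n+n≡m k≤m) (extend (m ∸ k))
    where
    extend : ∀ d → ∃ λ rest → tribWord (d + k) ≡ tribWord k ++ rest
    extend zero    = [] , sym (++-identityʳ (tribWord k))
    extend (suc d) with rest , eq ← extend d =
      rest ++ τ^ (d + k) [ a1 ] ,
      trans (tribWord-suc (d + k)) (trans (cong (_++ τ^ (d + k) [ a1 ]) eq) (++-assoc (tribWord k) rest _))

  take-tribWord-mono : ∀ {k m} N → k ≤ m → N ≤ length (tribWord k) → take N (tribWord m) ≡ take N (tribWord k)
  take-tribWord-mono N k≤m N≤ with rest , eq ← tribWord-mono k≤m =
    trans (cong (take N) eq) (take-++-≤ N _ rest N≤)

  prefix-tribWord : ∀ N k → N ≤ length (tribWord k) → prefix N ≡ take N (tribWord k)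
  prefix-tribWord N k N≤ with ≤-total N k
  ... | inj₁ N≤k = sym (take-tribWord-mono N N≤k (<⇒≤ (n<length-tribWord N)))
  ... | inj₂ k≤N = take-tribWord-mono N k≤N N≤

  length-prefix : ∀ N → length (prefix N) ≡ N
  length-prefix N = trans (length-take N (tribWord N)) (m≤n⇒m⊓n≡m (<⇒≤ (n<length-tribWord N)))

  -- The two complex eigenvalues of τ have modulus ≈ 0.737, and 0.737¹³ ≈ 0.019: this power
  -- makes the coupling coefficients of the discrepancy recursion small.
  σ : List Letter → List Letter
  σ = τ^ 13

  length-σ : ∀ w → 1705 * length w ≤ length (σ w)
  length-σ []      = z≤n
  length-σ (x ∷ w) = begin
    1705 * suc (length w)           ≡⟨ *-suc 1705 (length w) ⟩
    1705 + 1705 * length w          ≤⟨ +-mono-≤ (1705≤length-σ x) (length-σ w) ⟩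
    length (σ [ x ]) + length (σ w) ≡⟨ length-++ (σ [ x ]) ⟨
    length (σ [ x ] ++ σ w)         ≡⟨ cong length (τ^-++ 13 [ x ] w) ⟨
    length (σ (x ∷ w))              ∎
    where
    open ≤-Reasoning
    1705≤length-σ : ∀ x → 1705 ≤ length (σ [ x ])
    1705≤length-σ a0 = toWitness {a? = 1705 ≤? length (σ [ a0 ])} _
    1705≤length-σ a1 = toWitness {a? = 1705 ≤? length (σ [ a1 ])} _
    1705≤length-σ a2 = toWitness {a? = 1705 ≤? length (σ [ a2 ])} _

  σ-letter-prefix : ∀ x → ∃ λ rest → σ [ a0 ] ≡ σ [ x ] ++ rest
  σ-letter-prefix a0 = [] , sym (++-identityʳ (σ [ a0 ]))
  σ-letter-prefix a1 = drop 2632 (σ [ a0 ]) , refl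
  σ-letter-prefix a2 = drop 1705 (σ [ a0 ]) , refl

  length-σ-letter≤ : ∀ x → length (σ [ x ]) ≤ length (σ [ a0 ])
  length-σ-letter≤ x with rest , eq ← σ-letter-prefix x =
    subst (length (σ [ x ]) ≤_) (trans (sym (length-++ (σ [ x ]))) (cong length (sym eq))) (m≤m+n _ (length rest))

  take-σ-letter : ∀ x {L} → L ≤ length (σ [ x ]) → take L (σ [ x ]) ≡ take L (σ [ a0 ])
  take-σ-letter x {L} L≤ with rest , eq ← σ-letter-prefix x =
    trans (sym (take-++-≤ L (σ [ x ]) rest L≤)) (cong (take L) (sym eq))

  record Desubstitution (N : ℕ) : Set where
    field
      j L      : ℕ
      L≤       : L ≤ length (σ [ a0 ])
      prefix-≡ : prefix N ≡ σ (prefix j) ++ take L (σ [ a0 ])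

  desubstitute : ∀ N → Desubstitution N
  desubstitute N = record
    { j = j ; L = L
    ; L≤ = ≤-trans (<⇒≤ L<) (length-σ-letter≤ x)
    ; prefix-≡ = begin
        prefix N
          ≡⟨ prefix-tribWord N (13 + N) N≤ ⟩
        take N (tribWord (13 + N))
          ≡⟨ cong (take N) (trans (τ^-+ 13 N [ a0 ]) (τ^-concatMap 13 w)) ⟩
        take N (concatMap σ[_] w)
          ≡⟨ take-≡ ⟩
        concatMap σ[_] (take j w) ++ take L (σ [ x ])
          ≡⟨ cong₂ _++_ (sym (τ^-concatMap 13 (take j w))) (take-σ-letter x (<⇒≤ L<)) ⟩
        σ (take j w) ++ take L (σ [ a0 ])
          ≡⟨ cong (λ v → σ v ++ take L (σ [ a0 ])) (prefix-tribWord j N j≤) ⟨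
        σ (prefix j) ++ take L (σ [ a0 ]) ∎ }
    where
    open ≡-Reasoning
    w = tribWord N
    σ[_] : Letter → List Letter
    σ[ x ] = σ [ x ]
    σw-longer : length w ≤ length (σ w)
    σw-longer = length-τ^ 13 w
    N≤ : N ≤ length (tribWord (13 + N))
    N≤ = ≤-trans (<⇒≤ (n<length-tribWord N)) (subst (length w ≤_) (cong length (sym (τ^-+ 13 N [ a0 ]))) σw-longer)
    N< : N < length (concatMap σ[_] w)
    N< = subst (N <_) (cong length (τ^-concatMap 13 w)) (≤-trans (n<length-tribWord N) σw-longer)
    open TakeConcatMap (take-concatMap σ[_] w N N<)

  desubstitution-shrinks : ∀ {N} (d : Desubstitution N) → 1705 * Desubstitution.j d ≤ N
  desubstitution-shrinks {N} d = begin
    1705 * j                                           ≡⟨ cong (1705 *_) (length-prefix j) ⟨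
    1705 * length (prefix j)                           ≤⟨ length-σ (prefix j) ⟩
    length (σ (prefix j))                              ≤⟨ m≤m+n _ _ ⟩
    length (σ (prefix j)) + length (take L (σ [ a0 ])) ≡⟨ length-++ (σ (prefix j)) ⟨
    length (σ (prefix j) ++ take L (σ [ a0 ]))         ≡⟨ cong length prefix-≡ ⟨
    length (prefix N)                                  ≡⟨ length-prefix N ⟩
    N                                                  ∎
    where
    open ≤-Reasoning
    open Desubstitution d

open Prefixes

open import Data.Rational
  using (ℚ; 0ℚ; 1ℚ; _+_; _*_; _-_; -_; _/_; 1/_; _≤_; _<_; ∣_∣; _≤ᵇ_; toℚᵘ; NonZero; nonNegative; positive)
open import Data.Rational.Properties
open import Algebra.Definitions.RawSemiring Data.Rational.+-*-rawSemiring using (_^_)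
import Data.Rational.Unnormalised as ℚᵘ
import Data.Rational.Unnormalised.Properties as ℚᵘ

ℚ-ring : AlmostCommutativeRing _ _
ℚ-ring = fromCommutativeRing +-*-commutativeRing (λ p → dec⇒maybe (0ℚ ≟ p))

<-eval : ∀ {p q} → True (p <? q) → p < q
<-eval = toWitness

toℚᵘ-ℕ→ℚ : ∀ n → toℚᵘ (ℕ→ℚ n) ≡ ℚᵘ.mkℚᵘ (+ n) 0
toℚᵘ-ℕ→ℚ n = cong toℚᵘ (normalize-coprime {n} {0} (Coprimality.sym (Coprimality.1-coprimeTo n)))

ℕ→ℚ-+ : ∀ m n → ℕ→ℚ (m ℕ.+ n) ≡ ℕ→ℚ m + ℕ→ℚ n
ℕ→ℚ-+ m n = toℚᵘ-injective (begin
  toℚᵘ (ℕ→ℚ (m ℕ.+ n))                 ≡⟨ toℚᵘ-ℕ→ℚ (m ℕ.+ n) ⟩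
  ℚᵘ.mkℚᵘ (+ (m ℕ.+ n)) 0              ≡⟨ cong (λ i → ℚᵘ.mkℚᵘ i 0) (ℤ.pos-+ m n) ⟩
  ℚᵘ.mkℚᵘ (+ m ℤ.+ + n) 0              ≈⟨ ℚᵘ.*≡* (integral (+ m) (+ n)) ⟩
  ℚᵘ.mkℚᵘ (+ m) 0 ℚᵘ.+ ℚᵘ.mkℚᵘ (+ n) 0 ≡⟨ cong₂ ℚᵘ._+_ (toℚᵘ-ℕ→ℚ m) (toℚᵘ-ℕ→ℚ n) ⟨
  toℚᵘ (ℕ→ℚ m) ℚᵘ.+ toℚᵘ (ℕ→ℚ n)       ≈⟨ toℚᵘ-homo-+ (ℕ→ℚ m) (ℕ→ℚ n) ⟨
  toℚᵘ (ℕ→ℚ m + ℕ→ℚ n)                 ∎)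
  where
  open ℚᵘ.≃-Reasoning
  integral : ∀ a b → (a ℤ.+ b) ℤ.* (+ 1 ℤ.* + 1) ≡ (a ℤ.* + 1 ℤ.+ b ℤ.* + 1) ℤ.* + 1
  integral = ℤ-Solver.solve-∀

ℕ→ℚ-* : ∀ m n → ℕ→ℚ (m ℕ.* n) ≡ ℕ→ℚ m * ℕ→ℚ n
ℕ→ℚ-* zero    n = sym (*-zeroˡ (ℕ→ℚ n))
ℕ→ℚ-* (suc m) n = begin
  ℕ→ℚ (n ℕ.+ m ℕ.* n)   ≡⟨ ℕ→ℚ-+ n (m ℕ.* n) ⟩
  ℕ→ℚ n + ℕ→ℚ (m ℕ.* n) ≡⟨ cong (λ x → ℕ→ℚ n + x) (ℕ→ℚ-* m n) ⟩
  ℕ→ℚ n + ℕ→ℚ m * ℕ→ℚ n ≡⟨ distrib (ℕ→ℚ m) (ℕ→ℚ n) ⟩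
  (1ℚ + ℕ→ℚ m) * ℕ→ℚ n  ≡⟨ cong (_* ℕ→ℚ n) (ℕ→ℚ-+ 1 m) ⟨
  ℕ→ℚ (suc m) * ℕ→ℚ n   ∎
  where
  open ≡-Reasoning
  distrib : ∀ a b → b + a * b ≡ (1ℚ + a) * b
  distrib = solve-∀ ℚ-ring

0≤ℕ→ℚ : ∀ n → 0ℚ ≤ ℕ→ℚ n
0≤ℕ→ℚ n = nonNegative⁻¹ (ℕ→ℚ n) {{normalize-nonNeg n 1}}

ℕ→ℚ-mono-≤ : ∀ {m n} → m ℕ.≤ n → ℕ→ℚ m ≤ ℕ→ℚ n
ℕ→ℚ-mono-≤ {m} m≤n with d , refl ← ℕ.m≤n⇒∃[o]m+o≡n m≤n =
  subst₂ _≤_ (+-identityʳ (ℕ→ℚ m)) (sym (ℕ→ℚ-+ m d)) (+-monoʳ-≤ (ℕ→ℚ m) (0≤ℕ→ℚ d))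

neg-involutive : ∀ p → - (- p) ≡ p
neg-involutive = solve-∀ ℚ-ring

p≤p+q : ∀ p {q} → 0ℚ ≤ q → p ≤ p + q
p≤p+q p 0≤q = subst (_≤ p + _) (+-identityʳ p) (+-monoʳ-≤ p 0≤q)

p<q⇒0<q-p : ∀ {p q} → p < q → 0ℚ < q - p
p<q⇒0<q-p {p} {q} p<q = subst (_< q - p) (+-inverseʳ p) (+-monoˡ-< (- p) p<q)

p≤q⇒0≤q-p : ∀ {p q} → p ≤ q → 0ℚ ≤ q - p
p≤q⇒0≤q-p {p} {q} p≤q = subst (_≤ q - p) (+-inverseʳ p) (+-monoˡ-≤ (- p) p≤q)

0<q-p⇒p<q : ∀ {p q} → 0ℚ < q - p → p < q
0<q-p⇒p<q {p} {q} 0<q-p = subst₂ _<_ (+-identityʳ p) (p+[q-p] p q) (+-monoʳ-< p 0<q-p)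
  where
  p+[q-p] : ∀ p q → p + (q - p) ≡ q
  p+[q-p] = solve-∀ ℚ-ring

0≤* : ∀ {p q} → 0ℚ ≤ p → 0ℚ ≤ q → 0ℚ ≤ p * q
0≤* {p} {q} 0≤p 0≤q = nonNegative⁻¹ _ {{nonNeg*nonNeg⇒nonNeg p {{nonNegative 0≤p}} q {{nonNegative 0≤q}}}}

0<* : ∀ {p q} → 0ℚ < p → 0ℚ < q → 0ℚ < p * q
0<* {p} {q} 0<p 0<q = positive⁻¹ _ {{pos*pos⇒pos p {{positive 0<p}} q {{positive 0<q}}}}

square-mono : ∀ {p q} → 0ℚ ≤ p → p ≤ q → p * p ≤ q * q
square-mono {p} {q} 0≤p p≤q = ≤-trans (*-monoˡ-≤-nonNeg p {{nonNegative 0≤p}} p≤q)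
                                      (*-monoʳ-≤-nonNeg q {{nonNegative (≤-trans 0≤p p≤q)}} p≤q)

-*-antimono : ∀ a {b s s'} → 0ℚ ≤ b → s ≤ s' → a - b * s' ≤ a - b * s
-*-antimono a {b} 0≤b s≤s' = +-monoʳ-≤ a (neg-antimono-≤ (*-monoˡ-≤-nonNeg b {{nonNegative 0≤b}} s≤s'))

+*-mono : ∀ a {b s s'} → 0ℚ ≤ b → s ≤ s' → a + b * s ≤ a + b * s'
+*-mono a {b} 0≤b s≤s' = +-monoʳ-≤ a (*-monoˡ-≤-nonNeg b {{nonNegative 0≤b}} s≤s')

p≤∣p∣ : ∀ p → p ≤ ∣ p ∣
p≤∣p∣ p with ∣p∣≡p∨∣p∣≡-p p
... | inj₁ ∣p∣≡p  = ≤-reflexive (sym ∣p∣≡p)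
... | inj₂ ∣p∣≡-p = ≤-trans (subst (_≤ 0ℚ) (neg-involutive p) (neg-antimono-≤ (subst (0ℚ ≤_) ∣p∣≡-p (0≤∣p∣ p))))
                            (0≤∣p∣ p)

∣p∣≤q⇒p≤q : ∀ {p q} → ∣ p ∣ ≤ q → p ≤ q
∣p∣≤q⇒p≤q {p} = ≤-trans (p≤∣p∣ p)

∣p∣≤q⇒-p≤q : ∀ {p q} → ∣ p ∣ ≤ q → - p ≤ q
∣p∣≤q⇒-p≤q {p} {q} ∣p∣≤q = ≤-trans (p≤∣p∣ (- p)) (subst (_≤ q) (sym (∣-p∣≡∣p∣ p)) ∣p∣≤q)

-q≤p≤q⇒∣p∣≤q : ∀ {p q} → - q ≤ p → p ≤ q → ∣ p ∣ ≤ q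
-q≤p≤q⇒∣p∣≤q {p} {q} -q≤p p≤q with ∣p∣≡p∨∣p∣≡-p p
... | inj₁ ∣p∣≡p  = subst (_≤ q) (sym ∣p∣≡p) p≤q
... | inj₂ ∣p∣≡-p = subst₂ _≤_ (sym ∣p∣≡-p) (neg-involutive q) (neg-antimono-≤ -q≤p)

∣p∣≤r-by-bounds : ∀ {p lo hi r} → lo ≤ p → p ≤ hi → - r ≤ lo → hi ≤ r → ∣ p ∣ ≤ r
∣p∣≤r-by-bounds lo≤p p≤hi -r≤lo hi≤r = -q≤p≤q⇒∣p∣≤q (≤-trans -r≤lo lo≤p) (≤-trans p≤hi hi≤r)

∣+∣≤ : ∀ {a b A B} → ∣ a ∣ ≤ A → ∣ b ∣ ≤ B → ∣ a + b ∣ ≤ A + B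
∣+∣≤ {a} {b} ∣a∣≤ ∣b∣≤ = ≤-trans (∣p+q∣≤∣p∣+∣q∣ a b) (+-mono-≤ ∣a∣≤ ∣b∣≤)

∣*∣≤ : ∀ {a b A B} → ∣ a ∣ ≤ A → ∣ b ∣ ≤ B → ∣ a * b ∣ ≤ A * B
∣*∣≤ {a} {b} {A} {B} ∣a∣≤ ∣b∣≤ = begin
  ∣ a * b ∣     ≡⟨ ∣p*q∣≡∣p∣*∣q∣ a b ⟩
  ∣ a ∣ * ∣ b ∣ ≤⟨ *-monoʳ-≤-nonNeg ∣ b ∣ {{nonNegative (0≤∣p∣ b)}} ∣a∣≤ ⟩
  A * ∣ b ∣     ≤⟨ *-monoˡ-≤-nonNeg A {{nonNegative (≤-trans (0≤∣p∣ a) ∣a∣≤)}} ∣b∣≤ ⟩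
  A * B         ∎
  where open ≤-Reasoning

straddle : ∀ {x y ε} → 0ℚ < x → y < 0ℚ → x - y ≤ ε → ∣ x ∣ ≤ ε × ∣ y ∣ ≤ ε
straddle {x} {y} 0<x y<0 x-y≤ε =
  subst (_≤ _) (sym (0≤p⇒∣p∣≡p (<⇒≤ 0<x))) (≤-trans (p≤p+q x 0≤-y) x-y≤ε) ,
  subst (_≤ _) (trans (sym (0≤p⇒∣p∣≡p 0≤-y)) (∣-p∣≡∣p∣ y))
    (≤-trans (subst (_≤ x - y) (+-identityˡ (- y)) (+-monoˡ-≤ (- y) (<⇒≤ 0<x))) x-y≤ε)
  where
  0≤-y : 0ℚ ≤ - y
  0≤-y = neg-antimono-≤ (<⇒≤ y<0)

count-++ : ∀ a xs ys → count a (xs ++ ys) ≡ count a xs ℕ.+ count a ys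
count-++ a xs ys = trans (cong length (filter-++ (_≟L a) xs ys)) (length-++ (filter (_≟L a) xs))

-- With t = 1/β, t and t² are the frequencies of the letters 0 and 1 in the Tribonacci word.
disc : Letter → ℚ → List Letter → ℚ
disc a p w = ℕ→ℚ (count a w) - ℕ→ℚ (length w) * p

D₁ D₀ : ℚ → List Letter → ℚ
D₁ t = disc a1 (t * t)
D₀ t = disc a0 t

record IsAdditive (F : List Letter → ℚ) : Set where
  field
    []-zero : F [] ≡ 0ℚ
    ++-homo : ∀ xs ys → F (xs ++ ys) ≡ F xs + F ys

disc-additive : ∀ a p → IsAdditive (disc a p)
disc-additive a p = record
  { []-zero = zero-minus p
  ; ++-homo = λ xs ys → trans
      (cong₂ (λ c l → c - l * p)
        (trans (cong ℕ→ℚ (count-++ a xs ys)) (ℕ→ℚ-+ (count a xs) (count a ys)))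
        (trans (cong ℕ→ℚ (length-++ xs)) (ℕ→ℚ-+ (length xs) (length ys))))
      (split (ℕ→ℚ (count a xs)) (ℕ→ℚ (count a ys)) (ℕ→ℚ (length xs)) (ℕ→ℚ (length ys)) p) }
  where
  zero-minus : ∀ p → 0ℚ - 0ℚ * p ≡ 0ℚ
  zero-minus = solve-∀ ℚ-ring
  split : ∀ c c' l l' p → (c + c') - (l + l') * p ≡ (c - l * p) + (c' - l' * p)
  split = solve-∀ ℚ-ring

∘τ^-additive : ∀ {F} n → IsAdditive F → IsAdditive (F ∘ τ^ n)
∘τ^-additive {F} n additive = record
  { []-zero = trans (cong F (τ^-[] n)) []-zero
  ; ++-homo = λ xs ys → trans (cong F (τ^-++ n xs ys)) (++-homo (τ^ n xs) (τ^ n ys)) }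
  where open IsAdditive additive

-- An additive F is determined by its values on the three letters, on which D₁ t, D₀ t and the
-- length are linearly independent.
module Coordinates (F : List Letter → ℚ) (t : ℚ) where

  cX cY cZ : ℚ
  cX = F [ a1 ] - F [ a2 ]
  cY = F [ a0 ] - F [ a2 ]
  cZ = F [ a2 ] + t * t * cX + t * cY

  letter : ∀ x → F [ x ] ≡ cX * D₁ t [ x ] + cY * D₀ t [ x ] + cZ
  letter a0 = e₀ (F [ a0 ]) (F [ a1 ]) (F [ a2 ]) t
    where
    e₀ : ∀ A₀ A₁ A₂ t → A₀ ≡ (A₁ - A₂) * (0ℚ - 1ℚ * (t * t)) + (A₀ - A₂) * (1ℚ - 1ℚ * t)
                                + (A₂ + t * t * (A₁ - A₂) + t * (A₀ - A₂))
    e₀ = solve-∀ ℚ-ring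
  letter a1 = e₁ (F [ a0 ]) (F [ a1 ]) (F [ a2 ]) t
    where
    e₁ : ∀ A₀ A₁ A₂ t → A₁ ≡ (A₁ - A₂) * (1ℚ - 1ℚ * (t * t)) + (A₀ - A₂) * (0ℚ - 1ℚ * t)
                                + (A₂ + t * t * (A₁ - A₂) + t * (A₀ - A₂))
    e₁ = solve-∀ ℚ-ring
  letter a2 = e₂ (F [ a0 ]) (F [ a1 ]) (F [ a2 ]) t
    where
    e₂ : ∀ A₀ A₁ A₂ t → A₂ ≡ (A₁ - A₂) * (0ℚ - 1ℚ * (t * t)) + (A₀ - A₂) * (0ℚ - 1ℚ * t)
                                + (A₂ + t * t * (A₁ - A₂) + t * (A₀ - A₂))
    e₂ = solve-∀ ℚ-ring

  expansion : IsAdditive F → ∀ w → F w ≡ cX * D₁ t w + cY * D₀ t w + cZ * ℕ→ℚ (length w)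
  expansion additive [] = trans []-zero (zero-combination cX cY cZ t)
    where
    open IsAdditive additive
    zero-combination : ∀ x y z s → 0ℚ ≡ x * (0ℚ - 0ℚ * (s * s)) + y * (0ℚ - 0ℚ * s) + z * 0ℚ
    zero-combination = solve-∀ ℚ-ring
  expansion additive (x ∷ w) = begin
    F ([ x ] ++ w)
      ≡⟨ ++-homo [ x ] w ⟩
    F [ x ] + F w
      ≡⟨ cong₂ _+_ (letter x) (expansion additive w) ⟩
    (cX * D₁ t [ x ] + cY * D₀ t [ x ] + cZ) + (cX * D₁ t w + cY * D₀ t w + cZ * ℕ→ℚ (length w))
      ≡⟨ regroup cX cY cZ (D₁ t [ x ]) (D₀ t [ x ]) (D₁ t w) (D₀ t w) (ℕ→ℚ (length w)) ⟩
    cX * (D₁ t [ x ] + D₁ t w) + cY * (D₀ t [ x ] + D₀ t w) + cZ * (1ℚ + ℕ→ℚ (length w))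
      ≡⟨ cong₂ (λ u v → cX * u + cY * v + cZ * (1ℚ + ℕ→ℚ (length w))) (D₁-homo [ x ] w) (D₀-homo [ x ] w) ⟨
    cX * D₁ t (x ∷ w) + cY * D₀ t (x ∷ w) + cZ * (1ℚ + ℕ→ℚ (length w))
      ≡⟨ cong (λ n → cX * D₁ t (x ∷ w) + cY * D₀ t (x ∷ w) + cZ * n) (ℕ→ℚ-+ 1 (length w)) ⟨
    cX * D₁ t (x ∷ w) + cY * D₀ t (x ∷ w) + cZ * ℕ→ℚ (length (x ∷ w)) ∎
    where
    open ≡-Reasoning
    open IsAdditive additive
    open IsAdditive (disc-additive a1 (t * t)) renaming (++-homo to D₁-homo) using ()
    open IsAdditive (disc-additive a0 t) renaming (++-homo to D₀-homo) using ()
    regroup : ∀ x y z u v u' v' n →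
      (x * u + y * v + z) + (x * u' + y * v' + z * n) ≡ x * (u + u') + y * (v + v') + z * (1ℚ + n)
    regroup = solve-∀ ℚ-ring

  expansion-with : IsAdditive F → ∀ {X Y Z} → cX ≡ X → cY ≡ Y → cZ ≡ Z →
                   ∀ w → F w ≡ X * D₁ t w + Y * D₀ t w + Z * ℕ→ℚ (length w)
  expansion-with additive refl refl refl = expansion additive

-- g t = -t³ f(1/t), so 1/β is the root of g in (0, 1).
g : ℚ → ℚ
g t = 1ℚ - t - t * t - t * t * t

X₁ Y₁ Z₁ X₀ Y₀ Z₀ : ℚ → ℚ
X₁ t = ℕ→ℚ 274 - ℕ→ℚ 927 * (t * t)
Y₁ t = ℕ→ℚ 423 - ℕ→ℚ 1431 * (t * t)
Z₁ t = g t * (ℕ→ℚ 504 + ℕ→ℚ 927 * t)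
X₀ t = ℕ→ℚ 504 - ℕ→ℚ 927 * t
Y₀ t = ℕ→ℚ 778 - ℕ→ℚ 1431 * t
Z₀ t = g t * ℕ→ℚ 927

-- (|σ x|, |σ x|₀, |σ x|₁) is (3136, 1705, 927), (2632, 1431, 778), (1705, 927, 504) for x = 0, 1, 2.
D₁-σ : ∀ t w → D₁ t (σ w) ≡ X₁ t * D₁ t w + Y₁ t * D₀ t w + Z₁ t * ℕ→ℚ (length w)
D₁-σ t = expansion-with (∘τ^-additive 13 (disc-additive a1 (t * t))) (cX≡ t) (cY≡ t) (cZ≡ t)
  where
  open Coordinates (D₁ t ∘ σ) t
  cX≡ : ∀ t → (ℕ→ℚ 778 - ℕ→ℚ 2632 * (t * t)) - (ℕ→ℚ 504 - ℕ→ℚ 1705 * (t * t)) ≡ ℕ→ℚ 274 - ℕ→ℚ 927 * (t * t)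
  cX≡ = solve-∀ ℚ-ring
  cY≡ : ∀ t → (ℕ→ℚ 927 - ℕ→ℚ 3136 * (t * t)) - (ℕ→ℚ 504 - ℕ→ℚ 1705 * (t * t)) ≡ ℕ→ℚ 423 - ℕ→ℚ 1431 * (t * t)
  cY≡ = solve-∀ ℚ-ring
  cZ≡ : ∀ t → (ℕ→ℚ 504 - ℕ→ℚ 1705 * (t * t))
        + t * t * ((ℕ→ℚ 778 - ℕ→ℚ 2632 * (t * t)) - (ℕ→ℚ 504 - ℕ→ℚ 1705 * (t * t)))
        + t * ((ℕ→ℚ 927 - ℕ→ℚ 3136 * (t * t)) - (ℕ→ℚ 504 - ℕ→ℚ 1705 * (t * t)))
        ≡ (1ℚ - t - t * t - t * t * t) * (ℕ→ℚ 504 + ℕ→ℚ 927 * t)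
  cZ≡ = solve-∀ ℚ-ring

D₀-σ : ∀ t w → D₀ t (σ w) ≡ X₀ t * D₁ t w + Y₀ t * D₀ t w + Z₀ t * ℕ→ℚ (length w)
D₀-σ t = expansion-with (∘τ^-additive 13 (disc-additive a0 t)) (cX≡ t) (cY≡ t) (cZ≡ t)
  where
  open Coordinates (D₀ t ∘ σ) t
  cX≡ : ∀ t → (ℕ→ℚ 1431 - ℕ→ℚ 2632 * t) - (ℕ→ℚ 927 - ℕ→ℚ 1705 * t) ≡ ℕ→ℚ 504 - ℕ→ℚ 927 * t
  cX≡ = solve-∀ ℚ-ring
  cY≡ : ∀ t → (ℕ→ℚ 1705 - ℕ→ℚ 3136 * t) - (ℕ→ℚ 927 - ℕ→ℚ 1705 * t) ≡ ℕ→ℚ 778 - ℕ→ℚ 1431 * t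
  cY≡ = solve-∀ ℚ-ring
  cZ≡ : ∀ t → (ℕ→ℚ 927 - ℕ→ℚ 1705 * t)
        + t * t * ((ℕ→ℚ 1431 - ℕ→ℚ 2632 * t) - (ℕ→ℚ 927 - ℕ→ℚ 1705 * t))
        + t * ((ℕ→ℚ 1705 - ℕ→ℚ 3136 * t) - (ℕ→ℚ 927 - ℕ→ℚ 1705 * t))
        ≡ (1ℚ - t - t * t - t * t * t) * ℕ→ℚ 927
  cZ≡ = solve-∀ ℚ-ring

-- tₗ < 1/β = 0.5436890127… < tᵤ
tₗ tᵤ : ℚ
tₗ = + 5436889 / 10000000
tᵤ = + 5436891 / 10000000

_∈I : ℚ → Set
t ∈I = tₗ ≤ t × t ≤ tᵤ

module _ {t : ℚ} (t∈I : t ∈I) where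

  private
    tₗ≤t : tₗ ≤ t
    tₗ≤t = proj₁ t∈I
    t≤tᵤ : t ≤ tᵤ
    t≤tᵤ = proj₂ t∈I

  -- Proved directly rather than as <⇒≤ 0<t, whose unfolding makes type checking very slow.
  0≤t : 0ℚ ≤ t
  0≤t = ≤-trans (≤ᵇ⇒≤ _) tₗ≤t

  0<t : 0ℚ < t
  0<t = <-≤-trans (<-eval _) tₗ≤t

  square-∈I : tₗ * tₗ ≤ t * t × t * t ≤ tᵤ * tᵤ
  square-∈I = square-mono (≤ᵇ⇒≤ _) tₗ≤t , square-mono 0≤t t≤tᵤ

  ∣X₁∣≤ : ∣ X₁ t ∣ ≤ + 193 / 10000
  ∣X₁∣≤ = ∣p∣≤r-by-bounds (-*-antimono (ℕ→ℚ 274) (0≤ℕ→ℚ 927) (proj₂ square-∈I))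
                          (-*-antimono (ℕ→ℚ 274) (0≤ℕ→ℚ 927) (proj₁ square-∈I)) (≤ᵇ⇒≤ _) (≤ᵇ⇒≤ _)

  ∣Y₁∣≤ : ∣ Y₁ t ∣ ≤ + 6 / 10000
  ∣Y₁∣≤ = ∣p∣≤r-by-bounds (-*-antimono (ℕ→ℚ 423) (0≤ℕ→ℚ 1431) (proj₂ square-∈I))
                          (-*-antimono (ℕ→ℚ 423) (0≤ℕ→ℚ 1431) (proj₁ square-∈I)) (≤ᵇ⇒≤ _) (≤ᵇ⇒≤ _)

  ∣X₀∣≤ : ∣ X₀ t ∣ ≤ + 4 / 10000
  ∣X₀∣≤ = ∣p∣≤r-by-bounds (-*-antimono (ℕ→ℚ 504) (0≤ℕ→ℚ 927) t≤tᵤ)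
                          (-*-antimono (ℕ→ℚ 504) (0≤ℕ→ℚ 927) tₗ≤t) (≤ᵇ⇒≤ _) (≤ᵇ⇒≤ _)

  ∣Y₀∣≤ : ∣ Y₀ t ∣ ≤ + 192 / 10000
  ∣Y₀∣≤ = ∣p∣≤r-by-bounds (-*-antimono (ℕ→ℚ 778) (0≤ℕ→ℚ 1431) t≤tᵤ)
                          (-*-antimono (ℕ→ℚ 778) (0≤ℕ→ℚ 1431) tₗ≤t) (≤ᵇ⇒≤ _) (≤ᵇ⇒≤ _)

  ∣Z₁∣≤ : ∣ Z₁ t ∣ ≤ ∣ g t ∣ * ℕ→ℚ 1008
  ∣Z₁∣≤ = ∣*∣≤ {g t} ≤-refl (∣p∣≤r-by-bounds (+*-mono (ℕ→ℚ 504) (0≤ℕ→ℚ 927) 0≤t)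
                                              (+*-mono (ℕ→ℚ 504) (0≤ℕ→ℚ 927) t≤tᵤ) (≤ᵇ⇒≤ _) (≤ᵇ⇒≤ _))

∣Z₀∣≡ : ∀ t → ∣ Z₀ t ∣ ≡ ∣ g t ∣ * ℕ→ℚ 927
∣Z₀∣≡ t = trans (∣p*q∣≡∣p∣*∣q∣ (g t) (ℕ→ℚ 927)) (cong (∣ g t ∣ *_) (0≤p⇒∣p∣≡p (0≤ℕ→ℚ 927)))

module _ (P : ℕ → ℕ → ℕ → Bool) where

  P-cong : ∀ {l l' n₀ n₀' n₁ n₁'} → l ≡ l' → n₀ ≡ n₀' → n₁ ≡ n₁' → T (P l n₀ n₁) → T (P l' n₀' n₁')
  P-cong refl refl refl holds = holds

  everyPrefixFrom : ℕ → ℕ → ℕ → List Letter → Bool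
  everyPrefixFrom l n₀ n₁ []      = P l n₀ n₁
  everyPrefixFrom l n₀ n₁ (x ∷ w) =
    P l n₀ n₁ ∧ everyPrefixFrom (suc l) (n₀ ℕ.+ count a0 [ x ]) (n₁ ℕ.+ count a1 [ x ]) w

  everyPrefix : List Letter → Bool
  everyPrefix = everyPrefixFrom 0 0 0

  everyPrefixFrom-sound : ∀ l n₀ n₁ w → T (everyPrefixFrom l n₀ n₁ w) → ∀ L → L ℕ.≤ length w →
    T (P (l ℕ.+ L) (n₀ ℕ.+ count a0 (take L w)) (n₁ ℕ.+ count a1 (take L w)))
  everyPrefixFrom-sound l n₀ n₁ w holds zero _ =
    P-cong (sym (ℕ.+-identityʳ l)) (sym (ℕ.+-identityʳ n₀)) (sym (ℕ.+-identityʳ n₁)) (head w holds)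
    where
    head : ∀ w → T (everyPrefixFrom l n₀ n₁ w) → T (P l n₀ n₁)
    head []      holds = holds
    head (x ∷ w) holds = proj₁ (Equivalence.to T-∧ holds)
  everyPrefixFrom-sound l n₀ n₁ (x ∷ w) holds (suc L) (s≤s L≤) =
    P-cong (sym (ℕ.+-suc l L)) (shift a0 n₀) (shift a1 n₁)
      (everyPrefixFrom-sound (suc l) _ _ w (proj₂ (Equivalence.to T-∧ holds)) L L≤)
    where
    shift : ∀ a n → n ℕ.+ count a [ x ] ℕ.+ count a (take L w) ≡ n ℕ.+ count a (x ∷ take L w)
    shift a n = trans (ℕ.+-assoc n _ _) (cong (n ℕ.+_) (sym (count-++ a [ x ] (take L w))))

  everyPrefix-sound : ∀ w → everyPrefix w ≡ true → ∀ L → L ℕ.≤ length w →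
    T (P L (count a0 (take L w)) (count a1 (take L w)))
  everyPrefix-sound w holds = everyPrefixFrom-sound 0 0 0 w (Equivalence.from T-≡ holds)

c₁ ρ₁ c₀ ρ₀ : ℚ
c₁ = - (+ 1 / 40)
ρ₁ = + 687 / 1000
c₀ = + 3 / 20
ρ₀ = + 62 / 100

-- The tested quantities are D₁ t w - c₁ and D₀ t w - c₀ at the endpoints of I,
-- for a word w with |w| = l, |w|₀ = n₀ and |w|₁ = n₁.
blockBounds : ℕ → ℕ → ℕ → Bool
blockBounds l n₀ n₁ =
  (- ρ₁ ≤ᵇ ℕ→ℚ n₁ - ℕ→ℚ l * (tᵤ * tᵤ) - c₁) ∧ (ℕ→ℚ n₁ - ℕ→ℚ l * (tₗ * tₗ) - c₁ ≤ᵇ ρ₁) ∧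
  (- ρ₀ ≤ᵇ ℕ→ℚ n₀ - ℕ→ℚ l * tᵤ - c₀) ∧ (ℕ→ℚ n₀ - ℕ→ℚ l * tₗ - c₀ ≤ᵇ ρ₀)

T-∧₄ : ∀ {a b c d} → T (a ∧ b ∧ c ∧ d) → T a × T b × T c × T d
T-∧₄ {true} {true} {true} {true} _ = _ , _ , _ , _

-- Stated with _≡ true rather than T: the type checker then evaluates the scan once, by refl.
blockBounds-σ0 : everyPrefix blockBounds (σ [ a0 ]) ≡ true
blockBounds-σ0 = refl

module _ {t : ℚ} (t∈I : t ∈I) where

  block-bounds : ∀ L → L ℕ.≤ length (σ [ a0 ]) →
    ∣ D₁ t (take L (σ [ a0 ])) - c₁ ∣ ≤ ρ₁ × ∣ D₀ t (take L (σ [ a0 ])) - c₀ ∣ ≤ ρ₀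
  block-bounds L L≤ = D₁-bound , D₀-bound
    where
    s : List Letter
    s = take L (σ [ a0 ])
    l : ℕ
    l = length s
    n₀ n₁ : ℚ
    n₀ = ℕ→ℚ (count a0 s)
    n₁ = ℕ→ℚ (count a1 s)
    holds : T (blockBounds l (count a0 s) (count a1 s))
    holds = subst (λ l → T (blockBounds l (count a0 s) (count a1 s)))
                  (sym (trans (length-take L (σ [ a0 ])) (ℕ.m≤n⇒m⊓n≡m L≤)))
                  (everyPrefix-sound blockBounds (σ [ a0 ]) blockBounds-σ0 L L≤)
    checks : T (- ρ₁ ≤ᵇ n₁ - ℕ→ℚ l * (tᵤ * tᵤ) - c₁) × T (n₁ - ℕ→ℚ l * (tₗ * tₗ) - c₁ ≤ᵇ ρ₁) ×
             T (- ρ₀ ≤ᵇ n₀ - ℕ→ℚ l * tᵤ - c₀) × T (n₀ - ℕ→ℚ l * tₗ - c₀ ≤ᵇ ρ₀)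
    checks = T-∧₄ holds
    D₁-bound : ∣ D₁ t s - c₁ ∣ ≤ ρ₁
    D₁-bound = ∣p∣≤r-by-bounds (+-monoˡ-≤ (- c₁) (-*-antimono n₁ (0≤ℕ→ℚ l) (proj₂ (square-∈I t∈I))))
                 (+-monoˡ-≤ (- c₁) (-*-antimono n₁ (0≤ℕ→ℚ l) (proj₁ (square-∈I t∈I))))
                 (≤ᵇ⇒≤ (proj₁ checks)) (≤ᵇ⇒≤ (proj₁ (proj₂ checks)))
    D₀-bound : ∣ D₀ t s - c₀ ∣ ≤ ρ₀
    D₀-bound = ∣p∣≤r-by-bounds (+-monoˡ-≤ (- c₀) (-*-antimono n₀ (0≤ℕ→ℚ l) (proj₂ t∈I)))
                 (+-monoˡ-≤ (- c₀) (-*-antimono n₀ (0≤ℕ→ℚ l) (proj₁ t∈I)))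
                 (≤ᵇ⇒≤ (proj₁ (proj₂ (proj₂ checks)))) (≤ᵇ⇒≤ (proj₂ (proj₂ (proj₂ checks))))

recursion-bound : ∀ {X Y Z u v s n x y K ε R R' ρ c c'} →
  ∣ X ∣ ≤ x → ∣ Y ∣ ≤ y → ∣ Z ∣ ≤ ε * K → 0ℚ ≤ n →
  ∣ u ∣ ≤ R + ε * n → ∣ v ∣ ≤ R' + ε * n → ∣ s ∣ ≤ ρ →
  ∣ X * u + Y * v + Z * n + (s + X * c + Y * c') ∣
    ≤ (x * R + y * R' + (ρ + x * ∣ c ∣ + y * ∣ c' ∣)) + (x + y + K) * (ε * n)
recursion-bound {X} {Y} {Z} {u} {v} {s} {n} {x} {y} {K} {ε} {R} {R'} {ρ} {c} {c'}
                ∣X∣≤ ∣Y∣≤ ∣Z∣≤ 0≤n ∣u∣≤ ∣v∣≤ ∣s∣≤ = begin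
  ∣ X * u + Y * v + Z * n + (s + X * c + Y * c') ∣
    ≤⟨ ∣+∣≤ (∣+∣≤ (∣+∣≤ (∣*∣≤ ∣X∣≤ ∣u∣≤) (∣*∣≤ ∣Y∣≤ ∣v∣≤)) (∣*∣≤ ∣Z∣≤ (≤-reflexive (0≤p⇒∣p∣≡p 0≤n))))
            (∣+∣≤ (∣+∣≤ ∣s∣≤ (∣*∣≤ ∣X∣≤ ≤-refl)) (∣*∣≤ ∣Y∣≤ ≤-refl)) ⟩
  x * (R + ε * n) + y * (R' + ε * n) + ε * K * n + (ρ + x * ∣ c ∣ + y * ∣ c' ∣)
    ≡⟨ regroup x y K ε R R' ρ (∣ c ∣) (∣ c' ∣) n ⟩
  (x * R + y * R' + (ρ + x * ∣ c ∣ + y * ∣ c' ∣)) + (x + y + K) * (ε * n) ∎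
  where
  open ≤-Reasoning
  regroup : ∀ x y K ε R R' ρ a a' n →
    x * (R + ε * n) + y * (R' + ε * n) + ε * K * n + (ρ + x * a + y * a')
      ≡ (x * R + y * R' + (ρ + x * a + y * a')) + (x + y + K) * (ε * n)
  regroup = solve-∀ ℚ-ring

R₁ R₀ : ℚ
R₁ = + 702 / 1000
R₀ = + 636 / 1000

record Balanced (t ε : ℚ) (w : List Letter) : Set where
  field
    D₁-bound : ∣ D₁ t w - c₁ ∣ ≤ R₁ + ε * ℕ→ℚ (length w)
    D₀-bound : ∣ D₀ t w - c₀ ∣ ≤ R₀ + ε * ℕ→ℚ (length w)

balanced-[] : ∀ {t ε} → 0ℚ ≤ ε → Balanced t ε []
balanced-[] {t} {ε} 0≤ε = record
  { D₁-bound = bound c₁ R₁ (IsAdditive.[]-zero (disc-additive a1 (t * t))) (≤ᵇ⇒≤ _)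
  ; D₀-bound = bound c₀ R₀ (IsAdditive.[]-zero (disc-additive a0 t)) (≤ᵇ⇒≤ _) }
  where
  bound : ∀ {d} c R → d ≡ 0ℚ → ∣ 0ℚ - c ∣ ≤ R → ∣ d - c ∣ ≤ R + ε * 0ℚ
  bound c R refl ∣c∣≤R = ≤-trans ∣c∣≤R (p≤p+q R (≤-reflexive (sym (*-zeroʳ ε))))

module _ {t ε : ℚ} (t∈I : t ∈I) (∣g∣≤ε : ∣ g t ∣ ≤ ε) where

  0≤ε : 0ℚ ≤ ε
  0≤ε = ≤-trans (0≤∣p∣ (g t)) ∣g∣≤ε

  ∣g∣*≤ε* : ∀ {Z K} → 0ℚ ≤ K → ∣ Z ∣ ≤ ∣ g t ∣ * K → ∣ Z ∣ ≤ ε * K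
  ∣g∣*≤ε* {K = K} 0≤K ∣Z∣≤ = ≤-trans ∣Z∣≤ (*-monoʳ-≤-nonNeg K {{nonNegative 0≤K}} ∣g∣≤ε)

  module _ {p : List Letter} {L : ℕ} (bal : Balanced t ε p) (L≤ : L ℕ.≤ length (σ [ a0 ])) where
    open Balanced bal
    private
      s w : List Letter
      s = take L (σ [ a0 ])
      w = σ p ++ s
      n : ℚ
      n = ℕ→ℚ (length p)

    error-growth : ∀ {k} → k ≤ ℕ→ℚ 1705 → k * (ε * n) ≤ ε * ℕ→ℚ (length w)
    error-growth {k} k≤ = begin
      k * (ε * n)                       ≤⟨ *-monoʳ-≤-nonNeg (ε * n) {{nonNegative 0≤εn}} k≤ ⟩
      ℕ→ℚ 1705 * (ε * n)                ≡⟨ swap (ℕ→ℚ 1705) ε n ⟩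
      ε * (ℕ→ℚ 1705 * n)                ≡⟨ cong (ε *_) (ℕ→ℚ-* 1705 (length p)) ⟨
      ε * ℕ→ℚ (1705 ℕ.* length p)       ≤⟨ *-monoˡ-≤-nonNeg ε {{nonNegative 0≤ε}} (ℕ→ℚ-mono-≤ 1705|p|≤|w|) ⟩
      ε * ℕ→ℚ (length w)                ∎
      where
      open ≤-Reasoning
      0≤εn : 0ℚ ≤ ε * n
      0≤εn = 0≤* 0≤ε (0≤ℕ→ℚ (length p))
      swap : ∀ a b c → a * (b * c) ≡ b * (a * c)
      swap = solve-∀ ℚ-ring
      1705|p|≤|w| : 1705 ℕ.* length p ℕ.≤ length w
      1705|p|≤|w| = ℕ.≤-trans (length-σ p) (subst (length (σ p) ℕ.≤_) (sym (length-++ (σ p))) (ℕ.m≤m+n _ _))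

    discrepancy-step : ∀ {F Fs X Y Z x y K e ρ R} →
      F ≡ X * D₁ t p + Y * D₀ t p + Z * n + Fs →
      ∣ X ∣ ≤ x → ∣ Y ∣ ≤ y → ∣ Z ∣ ≤ ε * K → ∣ Fs - e ∣ ≤ ρ →
      x * R₁ + y * R₀ + (ρ + x * ∣ c₁ ∣ + y * ∣ c₀ ∣) ≤ R → x + y + K ≤ ℕ→ℚ 1705 →
      ∣ F - e ∣ ≤ R + ε * ℕ→ℚ (length w)
    discrepancy-step {_} {Fs} {X} {Y} {Z} {x} {y} {K} {e} {ρ} {R}
                     refl ∣X∣≤ ∣Y∣≤ ∣Z∣≤ ∣Fs-e∣≤ const≤R rate≤ = begin
      ∣ X * D₁ t p + Y * D₀ t p + Z * n + Fs - e ∣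
        ≡⟨ cong ∣_∣ (recenter X Y Z (D₁ t p) (D₀ t p) n Fs e c₁ c₀) ⟩
      ∣ X * (D₁ t p - c₁) + Y * (D₀ t p - c₀) + Z * n + ((Fs - e) + X * c₁ + Y * c₀) ∣
        ≤⟨ recursion-bound {n = n} {ε = ε} ∣X∣≤ ∣Y∣≤ ∣Z∣≤ (0≤ℕ→ℚ (length p)) D₁-bound D₀-bound ∣Fs-e∣≤ ⟩
      (x * R₁ + y * R₀ + (ρ + x * ∣ c₁ ∣ + y * ∣ c₀ ∣)) + (x + y + K) * (ε * n)
        ≤⟨ +-mono-≤ const≤R (error-growth rate≤) ⟩
      R + ε * ℕ→ℚ (length w) ∎
      where
      open ≤-Reasoning
      recenter : ∀ X Y Z a b n s e c c' →
        X * a + Y * b + Z * n + s - e ≡ X * (a - c) + Y * (b - c') + Z * n + ((s - e) + X * c + Y * c')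
      recenter = solve-∀ ℚ-ring

    balanced-σ-++ : Balanced t ε w
    balanced-σ-++ = record
      { D₁-bound = discrepancy-step {e = c₁} {R = R₁} (split (disc-additive a1 (t * t)) (D₁-σ t p))
                     (∣X₁∣≤ t∈I) (∣Y₁∣≤ t∈I) (∣g∣*≤ε* (0≤ℕ→ℚ 1008) (∣Z₁∣≤ t∈I)) (proj₁ block) (≤ᵇ⇒≤ _) (≤ᵇ⇒≤ _)
      ; D₀-bound = discrepancy-step {e = c₀} {R = R₀} (split (disc-additive a0 t) (D₀-σ t p))
                     (∣X₀∣≤ t∈I) (∣Y₀∣≤ t∈I) (∣g∣*≤ε* (0≤ℕ→ℚ 927) (≤-reflexive (∣Z₀∣≡ t))) (proj₂ block)
                     (≤ᵇ⇒≤ _) (≤ᵇ⇒≤ _) }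
      where
      block : ∣ D₁ t s - c₁ ∣ ≤ ρ₁ × ∣ D₀ t s - c₀ ∣ ≤ ρ₀
      block = block-bounds t∈I L L≤
      split : ∀ {F} → IsAdditive F → ∀ {v} → F (σ p) ≡ v → F w ≡ v + F s
      split additive eq = trans (IsAdditive.++-homo additive (σ p) s) (cong (_+ _) eq)

  prefix-balanced : ∀ N → Balanced t ε (prefix N)
  prefix-balanced = <-rec (Balanced t ε ∘ prefix) λ N rec →
    let d = desubstitute N
        open Desubstitution d
    in subst (Balanced t ε) (sym prefix-≡) (balanced-σ-++ (earlier j (desubstitution-shrinks d) rec) L≤)
    where
    earlier : ∀ {N} j → 1705 ℕ.* j ℕ.≤ N → (∀ {m} → m ℕ.< N → Balanced t ε (prefix m)) →
              Balanced t ε (prefix j)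
    earlier zero    _      _   = balanced-[] 0≤ε
    earlier (suc j) 1705j≤ rec = rec (ℕ.<-≤-trans j<1705j 1705j≤)
      where
      j<1705j : suc j ℕ.< 1705 ℕ.* suc j
      j<1705j = subst (suc j ℕ.<_) (ℕ.*-comm (suc j) 1705) (ℕ.m<m*n (suc j) 1705 (ℕ.s≤s (ℕ.s≤s ℕ.z≤n)))

g-difference : ∀ a b → (1ℚ - a - a * a - a * a * a) - (1ℚ - b - b * b - b * b * b)
                     ≡ (b - a) * (1ℚ + a + b + a * a + a * b + b * b)
g-difference = solve-∀ ℚ-ring

module _ {a b : ℚ} (0≤a : 0ℚ ≤ a) (0≤b : 0ℚ ≤ b) where

  private
    E : ℚ
    E = 1ℚ + a + b + a * a + a * b + b * b

  0<E : 0ℚ < E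
  0<E = <-≤-trans (<-eval _) (≤-trans (≤-trans (≤-trans (≤-trans (p≤p+q 1ℚ 0≤a) (p≤p+q _ 0≤b))
          (p≤p+q _ (0≤* 0≤a 0≤a))) (p≤p+q _ (0≤* 0≤a 0≤b))) (p≤p+q _ (0≤* 0≤b 0≤b)))

  E≤6 : a ≤ 1ℚ → b ≤ 1ℚ → E ≤ ℕ→ℚ 6
  E≤6 a≤1 b≤1 =
    +-mono-≤ (+-mono-≤ (+-mono-≤ (+-mono-≤ (+-mono-≤ ≤-refl a≤1) b≤1) (≤1 0≤a a≤1 a≤1)) (≤1 0≤a a≤1 b≤1))
             (≤1 0≤b b≤1 b≤1)
    where
    ≤1 : ∀ {p q} → 0ℚ ≤ p → p ≤ 1ℚ → q ≤ 1ℚ → p * q ≤ 1ℚ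
    ≤1 {p} 0≤p p≤1 q≤1 =
      ≤-trans (*-monoˡ-≤-nonNeg p {{nonNegative 0≤p}} q≤1) (subst (_≤ 1ℚ) (sym (*-identityʳ p)) p≤1)

g-decreasing : ∀ {a b} → 0ℚ ≤ a → a < b → g b < g a
g-decreasing {a} {b} 0≤a a<b = 0<q-p⇒p<q (subst (0ℚ <_) (sym (g-difference a b))
  (0<* (p<q⇒0<q-p a<b) (0<E 0≤a (≤-trans 0≤a (<⇒≤ a<b)))))

g-lipschitz : ∀ {a b} → 0ℚ ≤ a → a ≤ b → b ≤ 1ℚ → g a - g b ≤ ℕ→ℚ 6 * (b - a)
g-lipschitz {a} {b} 0≤a a≤b b≤1 = begin
  g a - g b
    ≡⟨ g-difference a b ⟩
  (b - a) * (1ℚ + a + b + a * a + a * b + b * b)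
    ≤⟨ *-monoˡ-≤-nonNeg (b - a) {{nonNegative (p≤q⇒0≤q-p a≤b)}} (E≤6 0≤a (≤-trans 0≤a a≤b) (≤-trans a≤b b≤1) b≤1) ⟩
  (b - a) * ℕ→ℚ 6
    ≡⟨ *-comm (b - a) (ℕ→ℚ 6) ⟩
  ℕ→ℚ 6 * (b - a) ∎
  where open ≤-Reasoning

-- A Σ-type rather than a record: Agda normalises the field types of record and data
-- declarations, and with them the large literals tₗ and tᵤ.
Bracket : ℚ → Set
Bracket w = Σ[ a ∈ ℚ ] a ∈I × (a + w) ∈I × 0ℚ < g a × g (a + w) < 0ℚ

∈I-convex : ∀ {a w c} → a ∈I → (a + w) ∈I → 0ℚ ≤ w → 0ℚ ≤ c → c ≤ 1ℚ → (a + c * w) ∈I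
∈I-convex {a} {w} {c} a∈I a+w∈I 0≤w 0≤c c≤1 =
  ≤-trans (proj₁ a∈I) (p≤p+q a (0≤* 0≤c 0≤w)) ,
  ≤-trans (+-monoʳ-≤ a cw≤w) (proj₂ a+w∈I)
  where
  cw≤w : c * w ≤ w
  cw≤w = subst (c * w ≤_) (*-identityˡ w) (*-monoʳ-≤-nonNeg w {{nonNegative 0≤w}} c≤1)

⅓ ⅔ : ℚ
⅓ = + 1 / 3
⅔ = + 2 / 3

trisect : ∀ {w} → 0ℚ < w → Bracket w → Bracket (⅔ * w)
trisect {w} 0<w (a , a∈I , a+w∈I , 0<g[a] , g[a+w]<0) = choose (0ℚ <? g m₁)
  where
  m₁ m₂ : ℚ
  m₁ = a + ⅓ * w
  m₂ = a + ⅔ * w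
  m₁∈I : m₁ ∈I
  m₁∈I = ∈I-convex {c = ⅓} a∈I a+w∈I (<⇒≤ 0<w) (≤ᵇ⇒≤ _) (≤ᵇ⇒≤ _)
  m₂∈I : m₂ ∈I
  m₂∈I = ∈I-convex {c = ⅔} a∈I a+w∈I (<⇒≤ 0<w) (≤ᵇ⇒≤ _) (≤ᵇ⇒≤ _)
  thirds : m₁ + ⅔ * w ≡ a + w
  thirds = ⅓+⅔ a w
    where
    ⅓+⅔ : ∀ a w → a + ⅓ * w + ⅔ * w ≡ a + w
    ⅓+⅔ = solve-∀ ℚ-ring
  m₁<m₂ : m₁ < m₂
  m₁<m₂ = +-monoʳ-< a (*-monoˡ-<-pos w {{positive 0<w}} (<-eval {⅓} {⅔} _))
  choose : Dec (0ℚ < g m₁) → Bracket (⅔ * w)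
  choose (yes 0<g[m₁]) =
    m₁ , m₁∈I , subst _∈I (sym thirds) a+w∈I , 0<g[m₁] , subst (λ x → g x < 0ℚ) (sym thirds) g[a+w]<0
  choose (no 0≮g[m₁])  =
    a , a∈I , m₂∈I , 0<g[a] , <-≤-trans (g-decreasing (0≤t m₁∈I) m₁<m₂) (≮⇒≥ 0≮g[m₁])

module _ {θ : ℚ} (0<θ : 0ℚ < θ) (θ+θ≤1 : θ + θ ≤ 1ℚ) where

  private
    0≤θ : 0ℚ ≤ θ
    0≤θ = <⇒≤ 0<θ
    θ≤1 : θ ≤ 1ℚ
    θ≤1 = ≤-trans (p≤p+q θ 0≤θ) θ+θ≤1
    θ*≤θ : ∀ {p} → p ≤ 1ℚ → θ * p ≤ θ
    θ*≤θ {p} p≤1 = subst (θ * p ≤_) (*-identityʳ θ) (*-monoˡ-≤-nonNeg θ {{nonNegative 0≤θ}} p≤1)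

  0<^ : ∀ n → 0ℚ < θ ^ n
  0<^ zero    = <-eval _
  0<^ (suc n) = 0<* 0<θ (0<^ n)

  ^≤1 : ∀ n → θ ^ n ≤ 1ℚ
  ^≤1 zero    = ≤-refl
  ^≤1 (suc n) = ≤-trans (θ*≤θ (^≤1 n)) θ≤1

  n*^n≤1 : ∀ n → ℕ→ℚ n * θ ^ n ≤ 1ℚ
  n*^n≤1 zero    = ≤ᵇ⇒≤ _
  n*^n≤1 (suc n) = begin
    ℕ→ℚ (suc n) * (θ * θ ^ n)             ≡⟨ cong (_* (θ * θ ^ n)) (ℕ→ℚ-+ 1 n) ⟩
    (1ℚ + ℕ→ℚ n) * (θ * θ ^ n)            ≡⟨ expand (ℕ→ℚ n) θ (θ ^ n) ⟩
    θ * θ ^ n + θ * (ℕ→ℚ n * θ ^ n)       ≤⟨ +-mono-≤ (θ*≤θ (^≤1 n)) (θ*≤θ (n*^n≤1 n)) ⟩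
    θ + θ                                 ≤⟨ θ+θ≤1 ⟩
    1ℚ                                    ∎
    where
    open ≤-Reasoning
    expand : ∀ n θ p → (1ℚ + n) * (θ * p) ≡ θ * p + θ * (n * p)
    expand = solve-∀ ℚ-ring

θ w₀ : ℚ
θ  = ⅔ * ⅔
w₀ = tᵤ - tₗ

0<w : ∀ n → 0ℚ < w₀ * θ ^ n
0<w n = 0<* (<-eval {0ℚ} {w₀} _) (0<^ {θ} (<-eval _) (≤ᵇ⇒≤ _) n)

bracket : ∀ n → Bracket (w₀ * θ ^ n)
bracket zero    = tₗ , (≤-refl , ≤ᵇ⇒≤ _) , (≤ᵇ⇒≤ _ , ≤ᵇ⇒≤ _) , <-eval _ , <-eval _
bracket (suc n) =
  subst Bracket (regroup w₀ (θ ^ n)) (trisect (0<* (<-eval {0ℚ} {⅔} _) (0<w n)) (trisect (0<w n) (bracket n)))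
  where
  regroup : ∀ w p → ⅔ * (⅔ * (w * p)) ≡ w * (θ * p)
  regroup = solve-∀ ℚ-ring

module _ {t : ℚ} (0<t : 0ℚ < t) where

  private
    instance
      t≢0 : NonZero t
      t≢0 = pos⇒nonZero t {{positive 0<t}}
    r : ℚ
    r = 1/ t
    tr≡1 : t * r ≡ 1ℚ
    tr≡1 = *-inverseʳ t
    0<r : 0ℚ < r
    0<r = positive⁻¹ r {{1/pos⇒pos t {{positive 0<t}}}}
    0<t³ : 0ℚ < t * t * t
    0<t³ = 0<* (0<* 0<t 0<t) 0<t

    f[r]*t³≡g : f r * (t * t * t) ≡ g t
    f[r]*t³≡g = begin
      f r * (t * t * t)            ≡⟨ factor t r ⟩
      g t + (t * r - 1ℚ) * Q       ≡⟨ cong (λ u → g t + (u - 1ℚ) * Q) tr≡1 ⟩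
      g t + (1ℚ - 1ℚ) * Q          ≡⟨ vanish (g t) Q ⟩
      g t                          ∎
      where
      open ≡-Reasoning
      Q : ℚ
      Q = t * r * (t * r) + t * r + 1ℚ - t * (t * r + 1ℚ) - t * t
      factor : ∀ t r → (r * r * r - r * r - r - + 1 / 1) * (t * t * t)
                     ≡ (1ℚ - t - t * t - t * t * t)
                       + (t * r - 1ℚ) * (t * r * (t * r) + t * r + 1ℚ - t * (t * r + 1ℚ) - t * t)
      factor = solve-∀ ℚ-ring
      vanish : ∀ a q → a + (1ℚ - 1ℚ) * q ≡ a
      vanish = solve-∀ ℚ-ring

    cancel-t² : ∀ x → x * (t * t) * (r * r) ≡ x
    cancel-t² x = begin
      x * (t * t) * (r * r)        ≡⟨ regroup x t r ⟩
      x * ((t * r) * (t * r))      ≡⟨ cong (λ u → x * (u * u)) tr≡1 ⟩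
      x * (1ℚ * 1ℚ)                ≡⟨ *-identityʳ x ⟩
      x                            ∎
      where
      open ≡-Reasoning
      regroup : ∀ x t r → x * (t * t) * (r * r) ≡ x * ((t * r) * (t * r))
      regroup = solve-∀ ℚ-ring

    sign-f[r] : ∀ {x y} → x * (t * t * t) < y * (t * t * t) → x < y
    sign-f[r] = *-cancelʳ-<-nonNeg (t * t * t) {{nonNegative (<⇒≤ 0<t³)}}

    f[r]<0 : g t < 0ℚ → f r < 0ℚ
    f[r]<0 g<0 = sign-f[r] (begin-strict
      f r * (t * t * t) ≡⟨ f[r]*t³≡g ⟩
      g t               <⟨ g<0 ⟩
      0ℚ                ≡⟨ *-zeroˡ (t * t * t) ⟨
      0ℚ * (t * t * t)  ∎)
      where open ≤-Reasoning

    0<f[r] : 0ℚ < g t → 0ℚ < f r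
    0<f[r] 0<g = sign-f[r] (begin-strict
      0ℚ * (t * t * t)  ≡⟨ *-zeroˡ (t * t * t) ⟩
      0ℚ                <⟨ 0<g ⟩
      g t               ≡⟨ f[r]*t³≡g ⟨
      f r * (t * t * t) ∎)
      where open ≤-Reasoning

    ×r² : ∀ {x y} → x < y → x * (r * r) < y * (r * r)
    ×r² = *-monoˡ-<-pos (r * r) {{positive (0<* 0<r 0<r)}}

  Nβ⁻²-lt-intro : ∀ {N a} → g t < 0ℚ → ℕ→ℚ N * (t * t) < a → Nβ⁻²-lt N a
  Nβ⁻²-lt-intro {N} {a} g<0 Nt²<a =
    r , 0<r , f[r]<0 g<0 , subst (_< a * (r * r)) (cancel-t² (ℕ→ℚ N)) (×r² Nt²<a)

  lt-Nβ⁻²-intro : ∀ {N a} → 0ℚ < g t → a < ℕ→ℚ N * (t * t) → lt-Nβ⁻² a N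
  lt-Nβ⁻²-intro {N} {a} 0<g a<Nt² =
    r , 0<r , 0<f[r] 0<g , subst (a * (r * r) <_) (cancel-t² (ℕ→ℚ N)) (×r² a<Nt²)

frequency-bounds : ∀ {t ε} N → ε * ℕ→ℚ N ≤ + 1 / 25 →
  ∣ D₁ t (prefix N) - c₁ ∣ ≤ R₁ + ε * ℕ→ℚ (length (prefix N)) →
  ℕ→ℚ N * (t * t) < ℕ→ℚ (count a1 (prefix N)) + + 31 / 40 ×
  ℕ→ℚ (count a1 (prefix N)) - + 29 / 40 < ℕ→ℚ N * (t * t)
frequency-bounds {t} {ε} N εN≤ balanced = lower , upper
  where
  open ≤-Reasoning
  n₁ x d r : ℚ
  n₁ = ℕ→ℚ (count a1 (prefix N))
  x = ℕ→ℚ N * (t * t)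
  d = n₁ - x - c₁
  r = R₁ + + 1 / 25
  ∣d∣≤r : ∣ d ∣ ≤ r
  ∣d∣≤r = ≤-trans (subst (λ m → ∣ n₁ - ℕ→ℚ m * (t * t) - c₁ ∣ ≤ R₁ + ε * ℕ→ℚ m) (length-prefix N) balanced)
                  (+-monoʳ-≤ R₁ εN≤)
  lower : x < n₁ + + 31 / 40
  lower = begin-strict
    x                 ≡⟨ e n₁ x c₁ ⟩
    n₁ + (- d - c₁)   ≤⟨ +-monoʳ-≤ n₁ (+-monoˡ-≤ (- c₁) (∣p∣≤q⇒-p≤q ∣d∣≤r)) ⟩
    n₁ + (r - c₁)     <⟨ +-monoʳ-< n₁ (<-eval _) ⟩
    n₁ + + 31 / 40    ∎
    where
    e : ∀ n x c → x ≡ n + (- (n - x - c) - c)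
    e = solve-∀ ℚ-ring
  upper : n₁ - + 29 / 40 < x
  upper = begin-strict
    n₁ - + 29 / 40    <⟨ +-monoʳ-< n₁ (neg-antimono-< (<-eval {c₁ + r} {+ 29 / 40} _)) ⟩
    n₁ - (c₁ + r)     ≤⟨ +-monoʳ-≤ n₁ (neg-antimono-≤ (+-monoʳ-≤ c₁ (∣p∣≤q⇒p≤q ∣d∣≤r))) ⟩
    n₁ - (c₁ + d)     ≡⟨ e n₁ x c₁ ⟩
    x                 ∎
    where
    e : ∀ n x c → n - (c + (n - x - c)) ≡ x
    e = solve-∀ ℚ-ring

bracket-bounds : ∀ N {w} → ℕ→ℚ 6 * w * ℕ→ℚ N ≤ + 1 / 25 → 0ℚ ≤ w → Bracket w →
  Nβ⁻²-lt N (ℕ→ℚ (count a1 (prefix N)) + (+ 31 / 40))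
  × lt-Nβ⁻² (ℕ→ℚ (count a1 (prefix N)) - (+ 29 / 40)) N
bracket-bounds N {w} εN≤ 0≤w (a , a∈I , b∈I , 0<g[a] , g[b]<0) =
    Nβ⁻²-lt-intro (0<t b∈I) {N} g[b]<0
      (proj₁ (frequency-bounds {a + w} {ε} N εN≤ (D₁-bound b∈I (proj₂ ∣g∣≤ε))))
  , lt-Nβ⁻²-intro (0<t a∈I) {N} 0<g[a]
      (proj₂ (frequency-bounds {a} {ε} N εN≤ (D₁-bound a∈I (proj₁ ∣g∣≤ε))))
  where
  ε : ℚ
  ε = ℕ→ℚ 6 * w
  D₁-bound : ∀ {t} → t ∈I → ∣ g t ∣ ≤ ε → ∣ D₁ t (prefix N) - c₁ ∣ ≤ R₁ + ε * ℕ→ℚ (length (prefix N))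
  D₁-bound t∈I ∣g∣≤ε = Balanced.D₁-bound (prefix-balanced t∈I ∣g∣≤ε N)
  ∣g∣≤ε : ∣ g a ∣ ≤ ε × ∣ g (a + w) ∣ ≤ ε
  ∣g∣≤ε = straddle 0<g[a] g[b]<0 (subst (λ v → g a - g (a + w) ≤ ℕ→ℚ 6 * v) (shift a w)
            (g-lipschitz (0≤t a∈I) (p≤p+q a 0≤w) (≤-trans (proj₂ b∈I) (≤ᵇ⇒≤ _))))
    where
    shift : ∀ a w → a + w - a ≡ w
    shift = solve-∀ ℚ-ring

6*w*N≤1/25 : ∀ N → ℕ→ℚ 6 * (w₀ * θ ^ N) * ℕ→ℚ N ≤ + 1 / 25
6*w*N≤1/25 N = begin
  ℕ→ℚ 6 * (w₀ * θ ^ N) * ℕ→ℚ N     ≡⟨ regroup (ℕ→ℚ 6) w₀ (θ ^ N) (ℕ→ℚ N) ⟩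
  ℕ→ℚ 6 * w₀ * (ℕ→ℚ N * θ ^ N)
    ≤⟨ *-monoˡ-≤-nonNeg (ℕ→ℚ 6 * w₀) {{nonNegative {ℕ→ℚ 6 * w₀} (≤ᵇ⇒≤ _)}} (n*^n≤1 {θ} (<-eval _) (≤ᵇ⇒≤ _) N) ⟩
  ℕ→ℚ 6 * w₀ * 1ℚ                  ≤⟨ ≤ᵇ⇒≤ _ ⟩
  + 1 / 25                         ∎
  where
  open ≤-Reasoning
  regroup : ∀ s w p n → s * (w * p) * n ≡ s * w * (n * p)
  regroup = solve-∀ ℚ-ring

proposition2 : (N : ℕ) →
    Nβ⁻²-lt N (ℕ→ℚ (count a1 (prefix N)) + (+ 31 / 40))
    × lt-Nβ⁻² (ℕ→ℚ (count a1 (prefix N)) - (+ 29 / 40)) N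
proposition2 N = bracket-bounds N (6*w*N≤1/25 N) (<⇒≤ (0<w N)) (bracket N)
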